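{- In a Rado complex $X$, the link $\mathrm{Lk}_X(\sigma)$ of every simplex $\sigma$ of $X$ is a Rado complex.
   Context: The link $\mathrm{Lk}_X(\sigma)$ of a simplex $\sigma$ is the subcomplex of all simplexes $\tau$ of $X$ with $\tau\cap\sigma=\emptyset$ and $\tau\cup\sigma\in X$; for a vertex $v$, $\mathrm{Lk}_X(v)=\mathrm{Lk}_X(\{v\})$. For $U\subseteq V(X)$, $X_U$ denotes the induced subcomplex on $U$. A Rado complex is a simplicial complex with a countable vertex set which is $\infty$-ample: it is nonempty and for every finite $U\subseteq V(X)$ and every subcomplex $A\subseteq X_U$ (possibly empty) there exists $v\in V(X)\setminus U$ with $\mathrm{Lk}_X(v)\cap X_U=A$. -}

module Defs where

open import Data.Nat using (ℕ)
open import Data.List using (List; []; _∷_; _++_)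
open import Data.List.Membership.Propositional using (_∈_; _∉_)
open import Data.Product using (Σ; ∃; _×_)
open import Data.Empty using (⊥)
open import Relation.Binary.PropositionalEquality using (_≡_)
open import Function.Bundles using (_⇔_)

-- Simplicial complexes on an ambient vertex type V.
-- A (finite) simplex is represented by a list of vertices, read as the
-- finite set of its elements; a complex is a predicate on such lists.
SComplex : Set → Set₁
SComplex V = List V → Set

_⊆ₗ_ : {V : Set} → List V → List V → Set
σ ⊆ₗ τ = ∀ {x} → x ∈ σ → x ∈ τ

Disjoint : {V : Set} → List V → List V → Set
Disjoint σ τ = ∀ {x} → x ∈ σ → x ∈ τ → ⊥

-- Axioms of an (abstract) simplicial complex: simplices are nonempty,
-- and every nonempty subset of a simplex is a simplex.
-- (This also makes membership invariant under reordering/duplication.)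
-- The empty complex (no simplices at all) is allowed.
record IsComplex {V : Set} (X : SComplex V) : Set where
  field
    nonempty  : X [] → ⊥
    downClose : ∀ {σ τ} → X τ → σ ⊆ₗ τ → (σ ≡ [] → ⊥) → X σ

IsVertex : {V : Set} → SComplex V → V → Set
IsVertex X v = X (v ∷ [])

CountableVertices : {V : Set} → SComplex V → Set
CountableVertices {V} X =
  Σ (V → ℕ) λ f → ∀ v w → IsVertex X v → IsVertex X w → f v ≡ f w → v ≡ w

Lk : {V : Set} → SComplex V → List V → SComplex V
Lk X σ τ = (τ ≡ [] → ⊥) × Disjoint τ σ × X (τ ++ σ)

Induced : {V : Set} → SComplex V → List V → SComplex V
Induced X U τ = X τ × (τ ⊆ₗ U)

IsSubcomplex : {V : Set} → SComplex V → SComplex V → Set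
IsSubcomplex A Y = IsComplex A × (∀ τ → A τ → Y τ)

InfAmple : {V : Set} → SComplex V → Set₁
InfAmple {V} X =
  (∃ λ v → IsVertex X v) ×
  (∀ (U : List V) → (∀ {u} → u ∈ U → IsVertex X u) →
     ∀ (A : SComplex V) → IsSubcomplex A (Induced X U) →
     ∃ λ v → IsVertex X v × v ∉ U ×
       (∀ τ → ((Lk X (v ∷ []) τ × Induced X U τ) ⇔ A τ)))

IsRado : {V : Set} → SComplex V → Set₁
IsRado X = IsComplex X × CountableVertices X × InfAmple X

-- A simplex τ of Lk_X(σ) is recorded in X by τ ∪ σ, so an extension problem
-- (U, A) for the link becomes the extension problem (U ∪ σ, A * Δσ) for X,
-- where the join A * Δσ also contains the full simplex Δσ.  A vertex v solving
-- it sees σ in its link, hence lies in Lk_X(σ), and Lk_X(v) ∩ X_{U ∪ σ} = A * Δσ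
-- cuts down to Lk_{Lk_X(σ)}(v) ∩ (Lk_X(σ))_U = A because the simplices of A
-- are disjoint from σ.
module Submission where

open import Defs
open import Data.List using (List; []; _∷_; _++_; [_])
open import Data.List.Properties using (++-conicalˡ)
open import Data.List.Membership.Propositional using (_∈_; _∉_)
open import Data.List.Membership.Propositional.Properties using (∈-++⁻)
open import Data.List.Relation.Unary.Any using (here)
open import Data.List.Relation.Binary.Subset.Propositional.Properties
  using (xs⊆xs++ys; xs⊆ys++xs; ∈-∷⁺ʳ; ⊆-reflexive-↭)
  renaming (++⁺ˡ to ⊆-++⁺ˡ)
open import Data.List.Relation.Binary.Permutation.Propositional using (_↭_; ↭-sym; module PermutationReasoning)
open import Data.List.Relation.Binary.Permutation.Propositional.Properties using (↭-empty-inv; ++-assoc; ++-comm; ++⁺ˡ)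
open import Data.Product using (∃; _×_; _,_; proj₁; proj₂; map₂)
open import Data.Sum using (_⊎_; inj₁; inj₂; [_,_]′)
open import Data.Empty using (⊥; ⊥-elim)
open import Function using (_∘_; id)
open import Function.Bundles using (_⇔_; mk⇔; Equivalence)
open import Relation.Binary.PropositionalEquality using (_≢_; refl; subst)

private
  variable
    V : Set
    u v : V
    ρ σ τ U : List V

++-≢[] : τ ≢ [] → τ ++ ρ ≢ []
++-≢[] {τ = τ} {ρ} τ≢[] = τ≢[] ∘ ++-conicalˡ τ ρ

++-swapʳ-↭ : (τ ρ σ : List V) → (τ ++ ρ) ++ σ ↭ (τ ++ σ) ++ ρ
++-swapʳ-↭ τ ρ σ = begin
  (τ ++ ρ) ++ σ  ↭⟨ ++-assoc τ ρ σ ⟩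
  τ ++ (ρ ++ σ)  ↭⟨ ++⁺ˡ τ (++-comm ρ σ) ⟩
  τ ++ (σ ++ ρ)  ↭⟨ ↭-sym (++-assoc τ σ ρ) ⟩
  (τ ++ σ) ++ ρ  ∎
  where open PermutationReasoning

Disjoint-[_]ʳ : v ∉ τ → Disjoint τ [ v ]
Disjoint-[ v∉τ ]ʳ x∈τ (here refl) = v∉τ x∈τ

Disjoint-[_]ˡ : v ∉ τ → Disjoint [ v ] τ
Disjoint-[ v∉τ ]ˡ (here refl) = v∉τ

Disjoint-++ˡ : Disjoint τ σ → Disjoint ρ σ → Disjoint (τ ++ ρ) σ
Disjoint-++ˡ {τ = τ} τ#σ ρ#σ x∈τ++ρ = [ τ#σ , ρ#σ ]′ (∈-++⁻ τ x∈τ++ρ)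

module _ {X : SComplex V} (isComplex : IsComplex X) where
  open IsComplex isComplex

  simplex-resp-↭ : X τ → τ ↭ ρ → X ρ
  simplex-resp-↭ Xτ τ↭ρ = downClose Xτ (⊆-reflexive-↭ (↭-sym τ↭ρ))
    λ { refl → nonempty (subst X (↭-empty-inv τ↭ρ) Xτ) }

  simplex⇒vertex : X τ → u ∈ τ → IsVertex X u
  simplex⇒vertex Xτ u∈τ = downClose Xτ (∈-∷⁺ʳ u∈τ λ ()) λ ()

  Lk-isComplex : (σ : List V) → IsComplex (Lk X σ)
  Lk-isComplex σ = record
    { nonempty  = λ (ne , _) → ne refl
    ; downClose = λ (_ , τ#σ , Xτσ) ρ⊆τ ρ≢[] →
        ρ≢[] , τ#σ ∘ ρ⊆τ , downClose Xτσ (⊆-++⁺ˡ σ ρ⊆τ) (++-≢[] ρ≢[])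
    }

  Lk-vertex⇒vertex : IsVertex (Lk X σ) u → IsVertex X u
  Lk-vertex⇒vertex (_ , _ , Xuσ) = simplex⇒vertex Xuσ (here refl)

countable-⊆ : {X Y : SComplex V} → (∀ {u} → IsVertex Y u → IsVertex X u) →
  CountableVertices X → CountableVertices Y
countable-⊆ Y⊆X (f , f-inj) = f , λ v w Yv Yw → f-inj v w (Y⊆X Yv) (Y⊆X Yw)

ExtensionVertex : SComplex V → List V → SComplex V → V → Set
ExtensionVertex X U A v =
  IsVertex X v × v ∉ U × (∀ τ → (Lk X [ v ] τ × Induced X U τ) ⇔ A τ)

ExtensionProperty : SComplex V → Set₁
ExtensionProperty {V} X =
  ∀ (U : List V) → (∀ {u} → u ∈ U → IsVertex X u) →
  ∀ (A : SComplex V) → IsSubcomplex A (Induced X U) → ∃ (ExtensionVertex X U A)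

ExtensionProperty⇒vertex : {X : SComplex V} → ExtensionProperty X → ∃ (IsVertex X)
ExtensionProperty⇒vertex extension
  with v , Xv , _ ← extension [] (λ ()) (λ _ → ⊥) (record { nonempty = λ () ; downClose = λ () } , λ _ ())
  = v , Xv

Join : SComplex V → List V → SComplex V
Join A σ τ = τ ≢ [] × (τ ⊆ₗ σ ⊎ ∃ λ α → A α × τ ⊆ₗ (α ++ σ))

module _ {A : SComplex V} {σ : List V} where

  Join-isComplex : IsComplex (Join A σ)
  Join-isComplex = record
    { nonempty  = λ (ne , _) → ne refl
    ; downClose = λ where
        (_ , inj₁ τ⊆σ) ρ⊆τ ρ≢[] → ρ≢[] , inj₁ (τ⊆σ ∘ ρ⊆τ)
        (_ , inj₂ (α , Aα , τ⊆ασ)) ρ⊆τ ρ≢[] → ρ≢[] , inj₂ (α , Aα , τ⊆ασ ∘ ρ⊆τ)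
    }

  Join-base : σ ≢ [] → Join A σ σ
  Join-base σ≢[] = σ≢[] , inj₁ id

  Join-++ : IsComplex A → A τ → Join A σ (τ ++ σ)
  Join-++ {τ = τ} isComplexA Aτ =
    ++-≢[] {ρ = σ} (λ { refl → IsComplex.nonempty isComplexA Aτ }) , inj₂ (τ , Aτ , id)

  Join-++⁻ : IsComplex A → τ ≢ [] → Disjoint τ σ → Join A σ (τ ++ σ) → A τ
  Join-++⁻ {τ = []} _ τ≢[] _ _ = ⊥-elim (τ≢[] refl)
  Join-++⁻ {τ = x ∷ τ} _ _ τ#σ (_ , inj₁ τσ⊆σ) = ⊥-elim (τ#σ (here refl) (τσ⊆σ (here refl)))
  Join-++⁻ {τ = τ} isComplexA τ≢[] τ#σ (_ , inj₂ (α , Aα , τσ⊆ασ)) =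
    IsComplex.downClose isComplexA Aα τ⊆α τ≢[]
    where
    τ⊆α : τ ⊆ₗ α
    τ⊆α x∈τ = [ id , (λ x∈σ → ⊥-elim (τ#σ x∈τ x∈σ)) ]′
      (∈-++⁻ α (τσ⊆ασ (xs⊆xs++ys τ σ x∈τ)))

  Join-⊆-Induced : {X : SComplex V} → IsComplex X → X σ →
    IsSubcomplex A (Induced (Lk X σ) U) → ∀ τ → Join A σ τ → Induced X (U ++ σ) τ
  Join-⊆-Induced {U = U} isComplex Xσ _ τ (τ≢[] , inj₁ τ⊆σ) =
    IsComplex.downClose isComplex Xσ τ⊆σ τ≢[] , xs⊆ys++xs σ U ∘ τ⊆σ
  Join-⊆-Induced isComplex Xσ (_ , A⊆L) τ (τ≢[] , inj₂ (α , Aα , τ⊆ασ))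
    with (_ , _ , Xασ) , α⊆U ← A⊆L α Aα
    = IsComplex.downClose isComplex Xασ τ⊆ασ τ≢[] , ⊆-++⁺ˡ σ α⊆U ∘ τ⊆ασ

module _ {X : SComplex V} (isComplex : IsComplex X) {σ : List V} (Xσ : X σ)
         {U : List V} {A : SComplex V} (A⊆LU : IsSubcomplex A (Induced (Lk X σ) U)) where

  Lk-extensionVertex : ExtensionVertex X (U ++ σ) (Join A σ) v → ExtensionVertex (Lk X σ) U A v
  Lk-extensionVertex {v} (_ , v∉Uσ , link) = Lk-v , v∉U , λ τ → mk⇔ (to τ) (from τ)
    where
    v∉U : v ∉ U
    v∉U = v∉Uσ ∘ xs⊆xs++ys U σ

    v∉σ : v ∉ σ
    v∉σ = v∉Uσ ∘ xs⊆ys++xs σ U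

    Join-cone : Join A σ τ → X (τ ++ [ v ])
    Join-cone {τ} = proj₂ ∘ proj₂ ∘ proj₁ ∘ Equivalence.from (link τ)

    Lk-v : IsVertex (Lk X σ) v
    Lk-v = (λ ()) , Disjoint-[ v∉σ ]ˡ ,
      simplex-resp-↭ isComplex (Join-cone (Join-base λ { refl → IsComplex.nonempty isComplex Xσ }))
        (++-comm σ [ v ])

    to : ∀ τ → Lk (Lk X σ) [ v ] τ × Induced (Lk X σ) U τ → A τ
    to τ ((τ≢[] , _ , _ , _ , Xτvσ) , (_ , τ#σ , Xτσ) , τ⊆U) =
      Join-++⁻ (proj₁ A⊆LU) τ≢[] τ#σ (Equivalence.to (link (τ ++ σ)) (Lk-v-τσ , Xτσ , τσ⊆Uσ))
      where
      τσ⊆Uσ : (τ ++ σ) ⊆ₗ (U ++ σ)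
      τσ⊆Uσ = ⊆-++⁺ˡ σ τ⊆U
      Lk-v-τσ : Lk X [ v ] (τ ++ σ)
      Lk-v-τσ = ++-≢[] τ≢[] , Disjoint-[ v∉Uσ ∘ τσ⊆Uσ ]ʳ ,
        simplex-resp-↭ isComplex Xτvσ (++-swapʳ-↭ τ [ v ] σ)

    from : ∀ τ → A τ → Lk (Lk X σ) [ v ] τ × Induced (Lk X σ) U τ
    from τ Aτ with (τ≢[] , τ#σ , Xτσ) , τ⊆U ← proj₂ A⊆LU τ Aτ =
      (τ≢[] , Disjoint-[ v∉U ∘ τ⊆U ]ʳ , ++-≢[] τ≢[] , Disjoint-++ˡ τ#σ Disjoint-[ v∉σ ]ˡ ,
        simplex-resp-↭ isComplex (Join-cone (Join-++ (proj₁ A⊆LU) Aτ)) (++-swapʳ-↭ τ σ [ v ]))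
      , (τ≢[] , τ#σ , Xτσ) , τ⊆U

Lk-extensionProperty : {X : SComplex V} → IsComplex X → X σ →
  ExtensionProperty X → ExtensionProperty (Lk X σ)
Lk-extensionProperty {σ = σ} {X} isComplex Xσ extension U U⊆Lk A A⊆LkU =
  map₂ (Lk-extensionVertex isComplex Xσ A⊆LkU)
    (extension (U ++ σ) Uσ⊆X (Join A σ) (Join-isComplex , Join-⊆-Induced isComplex Xσ A⊆LkU))
  where
  Uσ⊆X : ∀ {u} → u ∈ U ++ σ → IsVertex X u
  Uσ⊆X u∈Uσ = [ Lk-vertex⇒vertex isComplex ∘ U⊆Lk , simplex⇒vertex isComplex Xσ ]′ (∈-++⁻ U u∈Uσ)

lemma10p4 : (V : Set) (X : SComplex V) → IsRado X →
    (σ : List V) → X σ → IsRado (Lk X σ)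
lemma10p4 V X (isComplex , countable , _ , extension) σ Xσ =
  Lk-isComplex isComplex σ ,
  countable-⊆ {X = X} {Y = Lk X σ} (Lk-vertex⇒vertex isComplex) countable ,
  ExtensionProperty⇒vertex Lk-extension , Lk-extension
  where
  Lk-extension : ExtensionProperty (Lk X σ)
  Lk-extension = Lk-extensionProperty isComplex Xσ extension
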